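{- Let $\Gamma_1,\Gamma_2,\ldots$ be an infinite sequence of countably infinite, locally finite graphs, each having at least one edge. Then the edge set of $R$ can be partitioned into spanning subgraphs $\Delta_1,\Delta_2,\ldots$ of $R$ (pairwise edge-disjoint, with the union of their edge sets equal to the edge set of $R$) such that $\Delta_i\cong\Gamma_i$ for every $i$.
   Context: A graph satisfies property $(\ast)$ if for all finitely many distinct vertices $u_1,\ldots,u_m,v_1,\ldots,v_n$ there exists a vertex $z$ adjacent to each $u_i$ and nonadjacent to each $v_j$. Up to isomorphism there is exactly one countable graph satisfying $(\ast)$; it is denoted $R$. A graph is locally finite if every vertex has finite degree. A spanning subgraph of $R$ has the same vertex set as $R$ and a subset of its edges. -}

module Defs where

open import Data.Nat using (ℕ)
open import Data.Bool using (Bool; true; false)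
open import Data.List using (List; _++_)
open import Data.List.Membership.Propositional using (_∈_)
open import Data.List.Relation.Unary.All using (All)
open import Data.List.Relation.Unary.Unique.Propositional using (Unique)
open import Data.Product using (Σ; ∃; ∃-syntax; _×_)
open import Function.Bundles using (_↔_; _⇔_; Inverse)
open import Relation.Binary.PropositionalEquality using (_≡_; _≢_)

record Graph : Set₁ where
  field
    V      : Set
    adj    : V → V → Bool
    sym    : ∀ u v → adj u v ≡ adj v u
    irrefl : ∀ v → adj v v ≡ false
open Graph public

_≅_ : Graph → Graph → Set
G ≅ H = Σ (V G ↔ V H) λ f →
  ∀ u v → adj H (Inverse.to f u) (Inverse.to f v) ≡ adj G u v

CountablyInfinite : Graph → Set
CountablyInfinite G = V G ↔ ℕ

LocallyFinite : Graph → Set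
LocallyFinite G = ∀ v → ∃[ ns ] (∀ w → (adj G v w ≡ true) ⇔ (w ∈ ns))

HasEdge : Graph → Set
HasEdge G = ∃[ u ] ∃[ v ] adj G u v ≡ true

Extension : Graph → Set
Extension G = ∀ (us vs : List (V G)) → Unique (us ++ vs) →
  ∃[ z ] (All (λ u → adj G z u ≡ true) us × All (λ v → adj G z v ≡ false) vs)

record SpanningSubgraph (G : Graph) : Set where
  field
    sadj    : V G → V G → Bool
    ssym    : ∀ u v → sadj u v ≡ sadj v u
    sub     : ∀ u v → sadj u v ≡ true → adj G u v ≡ true
open SpanningSubgraph public

asGraph : {G : Graph} → SpanningSubgraph G → Graph
asGraph {G} Δ = record
  { V = V G
  ; adj = sadj Δ
  ; sym = ssym Δ
  ; irrefl = λ v → irr v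
  }
  where
  open import Data.Bool.Properties using (¬-not)
  open import Relation.Nullary using (¬_)
  irr : ∀ v → sadj Δ v v ≡ false
  irr v with sadj Δ v v in eq
  ... | false = Relation.Binary.PropositionalEquality.refl
  ... | true with Relation.Binary.PropositionalEquality.trans (Relation.Binary.PropositionalEquality.sym (sub Δ v v eq)) (irrefl G v)
  ... | ()

EdgePartition : (G : Graph) → (ℕ → SpanningSubgraph G) → Set
EdgePartition G Δ =
  (∀ i j u v → i ≢ j → sadj (Δ i) u v ≡ true → sadj (Δ j) u v ≡ false) ×
  (∀ u v → adj G u v ≡ true → ∃[ i ] sadj (Δ i) u v ≡ true)

-- Code all vertex sets by ℕ and place every Γⱼ into R at once by a back-and-forth
-- construction. A finite list of placements (j , x , r), "vertex x of Γⱼ sits on r",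
-- is maintained such that each Γⱼ is placed injectively, its edges land on edges of R,
-- and no edge of R carries edges of two different Γⱼ. At step n, with (a , b) the n-th
-- pair: if ab is an edge of R not yet carried, an edge of the still unused Γₙ is put on
-- it; vertex b of Γₐ is put on a common neighbour in R of every vertex used so far,
-- so that all its edges land on new edges of R; and vertex b of R receives a vertex
-- of Γₐ adjacent to nothing placed so far, which exists since Γₐ is locally finite.
-- In the limit each Γⱼ is placed bijectively and every edge of R is carried exactly once.
module Submission where

open import Defs
open import Data.Bool using (Bool; true; false)
open import Data.Bool.Properties using (¬-not) renaming (_≟_ to _≟ᵇ_)
open import Data.Empty using (⊥-elim)
open import Data.List using (List; []; _∷_; _++_; map; concatMap; deduplicate)
open import Data.List.Extrema.Nat using (max; xs≤max)
open import Data.List.Membership.Propositional using (_∈_; _∉_; find; lose)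
open import Data.List.Membership.Propositional.Properties
  using (∈-map⁺; ∈-map⁻; ∈-concat⁺′; ∈-deduplicate⁺)
open import Data.List.Properties using (++-identityʳ)
open import Data.List.Relation.Binary.Subset.Propositional using (_⊆_)
open import Data.List.Relation.Unary.All as All using (All)
open import Data.List.Relation.Unary.Any using (here; there; any?)
open import Data.List.Relation.Unary.Unique.Propositional using (Unique)
open import Data.List.Relation.Unary.Unique.DecPropositional.Properties using (deduplicate-!)
open import Data.Nat using (ℕ; zero; suc; _+_; _≤_; _<_; _≤′_; ≤′-refl; ≤′-step; _⊔_; s≤s; z≤n; _≟_)
open import Data.Nat.Properties
  using (≤-trans; <-irrefl; n<1+n; m<n⇒m<1+n; +-suc; +-identityʳ; m≤m+n; +-monoʳ-≤; n≤1+n; suc-injective; ≤⇒≤′; m≤m⊔n; m≤n⊔m)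
open import Data.Product using (∃-syntax; _×_; _,_; proj₁; proj₂)
open import Data.Sum using (_⊎_; inj₁; inj₂)
open import Function using (_∘_; id)
open import Function.Bundles using (_↔_; _⇔_; Inverse; Equivalence; mk↔ₛ′; mk⇔)
open import Function.Construct.Composition using (_↔-∘_)
open import Function.Construct.Symmetry using (↔-sym)
open import Function.Properties.Inverse using (↔⇒↣)
open import Relation.Binary.Definitions using (DecidableEquality)
open import Relation.Binary.PropositionalEquality as ≡ using (_≡_; refl; trans; cong; cong₂; subst; subst₂)
open import Relation.Nullary using (Dec; yes; no; ¬_)
open import Relation.Nullary.Decidable using (map′; _×-dec_; ¬?; decidable-stable; via-injection)
open import Relation.Unary using (Decidable)

open Inverse using (to; from; strictlyInverseˡ; strictlyInverseʳ)

private
  variable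
    m n : ℕ

∃-∈? : {X : Set} {P : X → Set} → Decidable P → ∀ xs → Dec (∃[ x ] x ∈ xs × P x)
∃-∈? P? xs = map′ find (λ (_ , x∈xs , px) → lose x∈xs px) (any? P? xs)

fresh : List ℕ → ℕ
fresh xs = suc (max 0 xs)

fresh-∉ : ∀ xs → fresh xs ∉ xs
fresh-∉ xs m = <-irrefl refl (All.lookup (xs≤max 0 xs) m)

next : ℕ × ℕ → ℕ × ℕ
next (a , zero)  = zero , suc a
next (a , suc b) = suc a , b

unpair : ℕ → ℕ × ℕ
unpair zero    = 0 , 0
unpair (suc n) = next (unpair n)

unpair-sum-≤ : ∀ n → proj₁ (unpair n) + proj₂ (unpair n) ≤ n
unpair-sum-≤ zero = z≤n
unpair-sum-≤ (suc n) with unpair n | unpair-sum-≤ n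
... | a , zero  | a+0≤n = s≤s (≤-trans (m≤m+n a 0) a+0≤n)
... | a , suc b | a+b+1≤n = s≤s (≤-trans (+-monoʳ-≤ a (n≤1+n b)) a+b+1≤n)

unpair-fst-≤ : ∀ n → proj₁ (unpair n) ≤ n
unpair-fst-≤ n = ≤-trans (m≤m+n _ _) (unpair-sum-≤ n)

unpair-surjective : ∀ a b → ∃[ n ] unpair n ≡ (a , b)
unpair-surjective a b = go (a + b) a b refl
  where
  go : ∀ d a b → a + b ≡ d → ∃[ n ] unpair n ≡ (a , b)
  go d       zero    zero    _   = 0 , refl
  go d       (suc a) b       a+b≡d with go d a (suc b) (trans (+-suc a b) a+b≡d)
  ... | n , eq = suc n , cong next eq
  go zero    zero    (suc b) ()
  go (suc d) zero    (suc b) b≡d with go d b zero (trans (+-identityʳ b) (suc-injective b≡d))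
  ... | n , eq = suc n , cong next eq

unpair-elim : (P : ℕ → ℕ → Set) → (∀ n → P (proj₁ (unpair n)) (proj₂ (unpair n))) → ∀ a b → P a b
unpair-elim P P-unpair a b =
  let n , eq = unpair-surjective a b in subst (λ p → P (proj₁ p) (proj₂ p)) eq (P-unpair n)

CommonNeighbours : Graph → Set
CommonNeighbours G = ∀ us → ∃[ z ] All (λ u → adj G z u ≡ true) us

Extension⇒CommonNeighbours : (G : Graph) → DecidableEquality (V G) → Extension G → CommonNeighbours G
Extension⇒CommonNeighbours G _≟ᵥ_ ext us =
  let z , adjacent , _ = ext (deduplicate _≟ᵥ_ us) [] unique in
  z , All.tabulate (All.lookup adjacent ∘ ∈-deduplicate⁺ _≟ᵥ_)
  where
  unique : Unique (deduplicate _≟ᵥ_ us ++ [])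
  unique = subst Unique (≡.sym (++-identityʳ _)) (deduplicate-! _≟ᵥ_ us)

relabel : (G : Graph) → V G ↔ ℕ → Graph
relabel G e = record
  { V      = ℕ
  ; adj    = λ a b → adj G (from e a) (from e b)
  ; sym    = λ a b → sym G (from e a) (from e b)
  ; irrefl = λ a → irrefl G (from e a)
  }

module _ {G : Graph} (e : V G ↔ ℕ) where

  relabel-adj : ∀ u v → adj (relabel G e) (to e u) (to e v) ≡ adj G u v
  relabel-adj u v = cong₂ (adj G) (strictlyInverseʳ e u) (strictlyInverseʳ e v)

  relabel-CommonNeighbours : CommonNeighbours G → CommonNeighbours (relabel G e)
  relabel-CommonNeighbours common ws with common (map (from e) ws)
  ... | z , adjacent = to e z , All.tabulate λ {w} w∈ws →
    trans (cong (λ x → adj G x (from e w)) (strictlyInverseʳ e z)) (All.lookup adjacent (∈-map⁺ (from e) w∈ws))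

  relabel-LocallyFinite : LocallyFinite G → LocallyFinite (relabel G e)
  relabel-LocallyFinite finite a with finite (from e a)
  ... | ns , lists = map (to e) ns , λ b → mk⇔ (listed b) (adjacent b)
    where
    listed : ∀ b → adj G (from e a) (from e b) ≡ true → b ∈ map (to e) ns
    listed b ab = subst (_∈ map (to e) ns) (strictlyInverseˡ e b)
                        (∈-map⁺ (to e) (Equivalence.to (lists (from e b)) ab))

    adjacent : ∀ b → b ∈ map (to e) ns → adj G (from e a) (from e b) ≡ true
    adjacent b b∈ with ∈-map⁻ (to e) b∈
    ... | w , w∈ns , refl = trans (cong (adj G (from e a)) (strictlyInverseʳ e w))
                                  (Equivalence.from (lists w) w∈ns)

  relabel-HasEdge : HasEdge G → HasEdge (relabel G e)
  relabel-HasEdge (u , v , uv) = to e u , to e v , trans (relabel-adj u v) uv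

-- The spanning subgraphs of R are the pull-backs of the Γⱼ along the bijections place j.
record Packing (R : Graph) (Γ : ℕ → Graph) : Set where
  field
    place          : ∀ j → V R ↔ V (Γ j)
    edges-sound    : ∀ j u v → adj (Γ j) (to (place j) u) (to (place j) v) ≡ true → adj R u v ≡ true
    edges-disjoint : ∀ i j u v → adj (Γ i) (to (place i) u) (to (place i) v) ≡ true →
                     adj (Γ j) (to (place j) u) (to (place j) v) ≡ true → i ≡ j
    edges-covered  : ∀ u v → adj R u v ≡ true → ∃[ j ] adj (Γ j) (to (place j) u) (to (place j) v) ≡ true

Packing⇒EdgePartition : ∀ {R Γ} → Packing R Γ → ∃[ Δ ] (EdgePartition R Δ × (∀ i → asGraph (Δ i) ≅ Γ i))
Packing⇒EdgePartition {R} {Γ} P = Δ , (disjoint , edges-covered) , λ i → place i , λ _ _ → refl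
  where
  open Packing P
  Δ : ℕ → SpanningSubgraph R
  Δ i = record
    { sadj = λ u v → adj (Γ i) (to (place i) u) (to (place i) v)
    ; ssym = λ u v → sym (Γ i) (to (place i) u) (to (place i) v)
    ; sub  = edges-sound i
    }
  disjoint : ∀ i j u v → ¬ i ≡ j → sadj (Δ i) u v ≡ true → sadj (Δ j) u v ≡ false
  disjoint i j u v i≢j uv = ¬-not (i≢j ∘ edges-disjoint i j u v uv)

relabel-Packing : ∀ {R Γ} (eR : V R ↔ ℕ) (eΓ : ∀ j → V (Γ j) ↔ ℕ) →
                  Packing (relabel R eR) (λ j → relabel (Γ j) (eΓ j)) → Packing R Γ
relabel-Packing {R} eR eΓ P = record
  { place          = λ j → ↔-sym (eΓ j) ↔-∘ (place j ↔-∘ eR)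
  ; edges-sound    = λ j u v uv → trans (≡.sym (relabel-adj {R} eR u v)) (edges-sound j (to eR u) (to eR v) uv)
  ; edges-disjoint = λ i j u v → edges-disjoint i j (to eR u) (to eR v)
  ; edges-covered  = λ u v uv → edges-covered (to eR u) (to eR v) (trans (relabel-adj {R} eR u v) uv)
  }
  where open Packing P

module Construction
  (A : ℕ → ℕ → Bool)
  (A-sym : ∀ a b → A a b ≡ A b a)
  (A-irrefl : ∀ a → A a a ≡ false)
  (common-neighbour : ∀ ws → ∃[ z ] All (λ w → A z w ≡ true) ws)
  (G : ℕ → ℕ → ℕ → Bool)
  (G-sym : ∀ j x y → G j x y ≡ G j y x)
  (G-irrefl : ∀ j x → G j x x ≡ false)
  (locally-finite : ∀ j x → ∃[ ns ] (∀ y → (G j x y ≡ true) ⇔ (y ∈ ns)))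
  (has-edge : ∀ j → ∃[ p ] ∃[ q ] G j p q ≡ true)
  where

  A-loop : ∀ {a} → ¬ A a a ≡ true
  A-loop {a} aa with () ← trans (≡.sym aa) (A-irrefl a)

  G-loop : ∀ {j x} → ¬ G j x x ≡ true
  G-loop {j} {x} xx with () ← trans (≡.sym xx) (G-irrefl j x)

  A-sym′ : ∀ {a b} → A a b ≡ true → A b a ≡ true
  A-sym′ {a} {b} = trans (A-sym b a)

  G-sym′ : ∀ {j x y} → G j x y ≡ true → G j y x ≡ true
  G-sym′ {j} {x} {y} = trans (G-sym j y x)

  -- (j , x , r) records that vertex x of Γⱼ is placed on vertex r of R.
  Placement : Set
  Placement = ℕ × ℕ × ℕ

  Placements : Set
  Placements = List Placement

  Link : Placements → ℕ → ℕ → ℕ → Set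
  Link s j x t = ∃[ y ] (j , y , t) ∈ s × G j x y ≡ true

  Edge : Placements → ℕ → ℕ → ℕ → Set
  Edge s j r t = ∃[ x ] (j , x , r) ∈ s × Link s j x t

  Covered : Placements → ℕ → ℕ → Set
  Covered s a b = ∃[ j ] Edge s j a b

  Edge-sym : ∀ {s j r t} → Edge s j r t → Edge s j t r
  Edge-sym (x , x↦r , y , y↦t , xy) = y , y↦t , x , x↦r , G-sym′ xy

  Edge-mono : ∀ {s s′ j r t} → s ⊆ s′ → Edge s j r t → Edge s′ j r t
  Edge-mono s⊆s′ (x , x↦r , y , y↦t , xy) = x , s⊆s′ x↦r , y , s⊆s′ y↦t , xy

  record Valid (n : ℕ) (s : Placements) : Set where
    field
      index<      : ∀ {j x r} → (j , x , r) ∈ s → j < n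
      functional  : ∀ {j x r r′} → (j , x , r) ∈ s → (j , x , r′) ∈ s → r ≡ r′
      injective   : ∀ {j x x′ r} → (j , x , r) ∈ s → (j , x′ , r) ∈ s → x ≡ x′
      edge-sound  : ∀ {j r t} → Edge s j r t → A r t ≡ true
      edge-unique : ∀ {i j r t} → Edge s i r t → Edge s j r t → i ≡ j
  open Valid

  Valid-suc : ∀ {s} → Valid n s → Valid (suc n) s
  Valid-suc V = record
    { index< = m<n⇒m<1+n ∘ index< V ; functional = functional V ; injective = injective V
    ; edge-sound = edge-sound V ; edge-unique = edge-unique V }

  index-unused : ∀ {s x r} → Valid n s → (n , x , r) ∉ s
  index-unused V x↦r = <-irrefl refl (index< V x↦r)

  module Extend {n s j₀ x₀ r₀} (V : Valid n s) (j₀<n : j₀ < n)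
    (x₀-unplaced : ∀ {r} → (j₀ , x₀ , r) ∉ s)
    (r₀-unused   : ∀ {x} → (j₀ , x , r₀) ∉ s)
    (links-sound : ∀ {t} → Link s j₀ x₀ t → A r₀ t ≡ true)
    (links-new   : ∀ {i t} → Link s j₀ x₀ t → ¬ Edge s i r₀ t)
    where

    s₀ : Placements
    s₀ = (j₀ , x₀ , r₀) ∷ s

    NewEdge : ℕ → ℕ → Set
    NewEdge r t = (r ≡ r₀ × Link s j₀ x₀ t) ⊎ (t ≡ r₀ × Link s j₀ x₀ r)

    Edge-∷ : ∀ {j r t} → Edge s₀ j r t → Edge s j r t ⊎ (j ≡ j₀ × NewEdge r t)
    Edge-∷ (_ , here refl , _ , here refl , xx) = ⊥-elim (G-loop xx)
    Edge-∷ (_ , here refl , y , there y↦t , xy) = inj₂ (refl , inj₁ (refl , y , y↦t , xy))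
    Edge-∷ (x , there x↦r , _ , here refl , xy) = inj₂ (refl , inj₂ (refl , x , x↦r , G-sym′ xy))
    Edge-∷ (x , there x↦r , y , there y↦t , xy) = inj₁ (x , x↦r , y , y↦t , xy)

    NewEdge-sound : ∀ {r t} → NewEdge r t → A r t ≡ true
    NewEdge-sound (inj₁ (refl , link)) = links-sound link
    NewEdge-sound (inj₂ (refl , link)) = A-sym′ (links-sound link)

    NewEdge-new : ∀ {i r t} → NewEdge r t → ¬ Edge s i r t
    NewEdge-new (inj₁ (refl , link)) = links-new link
    NewEdge-new (inj₂ (refl , link)) = links-new link ∘ Edge-sym

    valid : Valid n s₀
    index< valid (here refl) = j₀<n
    index< valid (there x↦r) = index< V x↦r
    functional valid (here refl)  (here refl)   = refl
    functional valid (here refl)  (there x↦r′) = ⊥-elim (x₀-unplaced x↦r′)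
    functional valid (there x↦r) (here refl)   = ⊥-elim (x₀-unplaced x↦r)
    functional valid (there x↦r) (there x↦r′) = functional V x↦r x↦r′
    injective valid (here refl)  (here refl)   = refl
    injective valid (here refl)  (there x′↦r) = ⊥-elim (r₀-unused x′↦r)
    injective valid (there x↦r) (here refl)   = ⊥-elim (r₀-unused x↦r)
    injective valid (there x↦r) (there x′↦r) = injective V x↦r x′↦r
    edge-sound valid e with Edge-∷ e
    ... | inj₁ old      = edge-sound V old
    ... | inj₂ (_ , new) = NewEdge-sound new
    edge-unique valid e e′ with Edge-∷ e | Edge-∷ e′
    ... | inj₁ old       | inj₁ old′       = edge-unique V old old′
    ... | inj₁ old       | inj₂ (_ , new′) = ⊥-elim (NewEdge-new new′ old)
    ... | inj₂ (_ , new) | inj₁ old′       = ⊥-elim (NewEdge-new new old′)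
    ... | inj₂ (refl , _) | inj₂ (refl , _) = refl

  images : Placements → List ℕ
  images = map (proj₂ ∘ proj₂)

  hub : Placements → ℕ
  hub s = proj₁ (common-neighbour (images s))

  hub-adj : ∀ {s j x r} → (j , x , r) ∈ s → A (hub s) r ≡ true
  hub-adj {s} x↦r = All.lookup (proj₂ (common-neighbour (images s))) (∈-map⁺ (proj₂ ∘ proj₂) x↦r)

  hub-unused : ∀ {s j x} → (j , x , hub s) ∉ s
  hub-unused = A-loop ∘ hub-adj

  nbrs : ℕ → ℕ → List ℕ
  nbrs j x = proj₁ (locally-finite j x)

  nbrs-complete : ∀ {j x y} → G j x y ≡ true → y ∈ nbrs j x
  nbrs-complete {j} {x} {y} = Equivalence.to (proj₂ (locally-finite j x) y)

  -- Mixing the vertices of different Γⱼ only enlarges the set the newcomer avoids.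
  crowd : Placements → List ℕ
  crowd = concatMap λ (j , y , _) → y ∷ nbrs j y

  newcomer : Placements → ℕ
  newcomer s = fresh (crowd s)

  newcomer-unplaced : ∀ {s j r} → (j , newcomer s , r) ∉ s
  newcomer-unplaced {s} x↦r = fresh-∉ (crowd s) (∈-concat⁺′ (here refl) (∈-map⁺ _ x↦r))

  newcomer-isolated : ∀ {s j t} → ¬ Link s j (newcomer s) t
  newcomer-isolated {s} (y , y↦t , xy) =
    fresh-∉ (crowd s) (∈-concat⁺′ (there (nbrs-complete (G-sym′ xy))) (∈-map⁺ _ y↦t))

  placed? : ∀ j x s → Dec (∃[ r ] (j , x , r) ∈ s)
  placed? j x s = map′ (λ { (_ , x↦r , refl , refl) → _ , x↦r })
                       (λ (_ , x↦r) → _ , x↦r , refl , refl)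
                       (∃-∈? (λ (p : Placement) → (j ≟ proj₁ p) ×-dec (x ≟ proj₁ (proj₂ p))) s)

  used? : ∀ j r s → Dec (∃[ x ] (j , x , r) ∈ s)
  used? j r s = map′ (λ { (_ , x↦r , refl , refl) → _ , x↦r })
                     (λ (_ , x↦r) → _ , x↦r , refl , refl)
                     (∃-∈? (λ (p : Placement) → (j ≟ proj₁ p) ×-dec (r ≟ proj₂ (proj₂ p))) s)

  link? : ∀ s j x t → Dec (Link s j x t)
  link? s j x t = map′ (λ { (_ , y↦t , refl , refl , xy) → _ , y↦t , xy })
                       (λ (_ , y↦t , xy) → _ , y↦t , refl , refl , xy)
                       (∃-∈? (λ (p : Placement) → (j ≟ proj₁ p) ×-dec (t ≟ proj₂ (proj₂ p))
                                                   ×-dec (G j x (proj₁ (proj₂ p)) ≟ᵇ true)) s)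

  covered? : ∀ s a b → Dec (Covered s a b)
  covered? s a b = map′ (λ { (_ , x↦a , refl , link) → _ , _ , x↦a , link })
                        (λ (_ , _ , x↦a , link) → _ , x↦a , refl , link)
                        (∃-∈? (λ (p : Placement) → (a ≟ proj₂ (proj₂ p)) ×-dec link? s (proj₁ p) (proj₁ (proj₂ p)) b) s)

  forth′ : ∀ j x s → Dec (∃[ r ] (j , x , r) ∈ s) → Placements
  forth′ j x s (yes _) = s
  forth′ j x s (no _)  = (j , x , hub s) ∷ s

  back′ : ∀ j r s → Dec (∃[ x ] (j , x , r) ∈ s) → Placements
  back′ j r s (yes _) = s
  back′ j r s (no _)  = (j , newcomer s , r) ∷ s

  cover′ : ∀ n a b s → Dec (A a b ≡ true × ¬ Covered s a b) → Placements
  cover′ n a b s (yes _) = (n , proj₁ (proj₂ (has-edge n)) , a) ∷ (n , proj₁ (has-edge n) , b) ∷ s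
  cover′ n a b s (no _)  = s

  forth : ℕ → ℕ → Placements → Placements
  forth j x s = forth′ j x s (placed? j x s)

  back : ℕ → ℕ → Placements → Placements
  back j r s = back′ j r s (used? j r s)

  cover : ℕ → ℕ → ℕ → Placements → Placements
  cover n a b s = cover′ n a b s ((A a b ≟ᵇ true) ×-dec ¬? (covered? s a b))

  -- The n-th pair (a , b) is read as an edge of R to cover, as vertex b of Γₐ to place,
  -- and as vertex b of R to be reached by Γₐ; cover uses the index n, unused so far.
  step : ℕ → ℕ × ℕ → Placements → Placements
  step n (a , b) s = back a b (forth a b (cover n a b s))

  stage : ℕ → Placements
  stage zero    = []
  stage (suc n) = step n (unpair n) (stage n)

  valid-forth : ∀ {s j} x → Valid n s → j < n → Valid n (forth j x s)
  valid-forth {s = s} {j} x V j<n with placed? j x s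
  ... | yes _       = V
  ... | no unplaced = Extend.valid V j<n (λ x↦r → unplaced (_ , x↦r)) hub-unused
                        (λ (_ , y↦t , _) → hub-adj y↦t) (λ _ (_ , x↦hub , _) → hub-unused x↦hub)

  valid-back : ∀ {s j} r → Valid n s → j < n → Valid n (back j r s)
  valid-back {s = s} {j} r V j<n with used? j r s
  ... | yes _    = V
  ... | no unused = Extend.valid V j<n newcomer-unplaced (λ x↦r → unused (_ , x↦r))
                      (⊥-elim ∘ newcomer-isolated) (λ link → ⊥-elim (newcomer-isolated link))

  valid-place-edge : ∀ {s a b p q} → Valid n s → G n p q ≡ true → A a b ≡ true → ¬ Covered s a b →
                     Valid (suc n) ((n , q , a) ∷ (n , p , b) ∷ s)
  valid-place-edge {n} {s} {a} {b} {p} {q} V pq ab uncovered =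
    Extend.valid V₁ (n<1+n n) q-unplaced a-unused links-sound links-new
    where
    s₁ : Placements
    s₁ = (n , p , b) ∷ s

    unused : ∀ {x r} → (n , x , r) ∉ s
    unused = index-unused V

    V₁ : Valid (suc n) s₁
    V₁ = Extend.valid (Valid-suc V) (n<1+n n) unused unused
           (λ (_ , y↦t , _) → ⊥-elim (unused y↦t)) (λ (_ , y↦t , _) → ⊥-elim (unused y↦t))

    q-unplaced : ∀ {r} → (n , q , r) ∉ s₁
    q-unplaced (here refl)  = G-loop pq
    q-unplaced (there q↦r) = unused q↦r

    a-unused : ∀ {x} → (n , x , a) ∉ s₁
    a-unused (here refl)  = A-loop ab
    a-unused (there x↦a) = unused x↦a

    links-sound : ∀ {t} → Link s₁ n q t → A a t ≡ true
    links-sound (_ , here refl , _)   = ab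
    links-sound (_ , there y↦t , _) = ⊥-elim (unused y↦t)

    links-new : ∀ {i t} → Link s₁ n q t → ¬ Edge s₁ i a t
    links-new (_ , here refl , _)   (_ , here refl , _)                 = A-loop ab
    links-new (_ , here refl , _)   (_ , there x↦a , _ , here refl , _) = unused x↦a
    links-new (_ , here refl , _)   (x , there x↦a , y , there y↦b , xy) = uncovered (_ , x , x↦a , y , y↦b , xy)
    links-new (_ , there y↦t , _) _ = unused y↦t

  valid-cover : ∀ {s} a b → Valid n s → Valid (suc n) (cover n a b s)
  valid-cover {n} {s} a b V with (A a b ≟ᵇ true) ×-dec ¬? (covered? s a b)
  ... | yes (ab , uncovered) = valid-place-edge V (proj₂ (proj₂ (has-edge n))) ab uncovered
  ... | no _                 = Valid-suc V

  valid-step : ∀ {s} p → Valid n s → proj₁ p < suc n → Valid (suc n) (step n p s)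
  valid-step (a , b) V a< = valid-back b (valid-forth b (valid-cover a b V) a<) a<

  valid-stage : ∀ n → Valid n (stage n)
  valid-stage zero    = record
    { index< = λ () ; functional = λ () ; injective = λ () ; edge-sound = λ () ; edge-unique = λ () }
  valid-stage (suc n) = valid-step (unpair n) (valid-stage n) (s≤s (unpair-fst-≤ n))

  forth-⊇ : ∀ j x s → s ⊆ forth j x s
  forth-⊇ j x s with placed? j x s
  ... | yes _ = id
  ... | no _  = there

  back-⊇ : ∀ j r s → s ⊆ back j r s
  back-⊇ j r s with used? j r s
  ... | yes _ = id
  ... | no _  = there

  cover-⊇ : ∀ n a b s → s ⊆ cover n a b s
  cover-⊇ n a b s with (A a b ≟ᵇ true) ×-dec ¬? (covered? s a b)
  ... | yes _ = there ∘ there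
  ... | no _  = id

  forth-places : ∀ j x s → ∃[ r ] (j , x , r) ∈ forth j x s
  forth-places j x s with placed? j x s
  ... | yes placed = placed
  ... | no _       = _ , here refl

  back-places : ∀ j r s → ∃[ x ] (j , x , r) ∈ back j r s
  back-places j r s with used? j r s
  ... | yes used = used
  ... | no _     = _ , here refl

  cover-covers : ∀ n a b s → A a b ≡ true → Covered (cover n a b s) a b
  cover-covers n a b s ab with (A a b ≟ᵇ true) ×-dec ¬? (covered? s a b)
  ... | yes _         = n , _ , here refl , _ , there (here refl) , G-sym′ (proj₂ (proj₂ (has-edge n)))
  ... | no ¬uncovered = decidable-stable (covered? s a b) (¬uncovered ∘ (ab ,_))

  step-⊇ : ∀ n p s → s ⊆ step n p s
  step-⊇ n (a , b) s = back-⊇ a b _ ∘ forth-⊇ a b _ ∘ cover-⊇ n a b s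

  stage-mono : m ≤ n → stage m ⊆ stage n
  stage-mono = go ∘ ≤⇒≤′
    where
    go : m ≤′ n → stage m ⊆ stage n
    go ≤′-refl              = id
    go (≤′-step {n} m≤′n) = step-⊇ n (unpair n) (stage n) ∘ go m≤′n

  step-places-forth : ∀ n p s → ∃[ r ] (proj₁ p , proj₂ p , r) ∈ step n p s
  step-places-forth n (a , b) s =
    let r , b↦r = forth-places a b (cover n a b s) in r , back-⊇ a b (forth a b (cover n a b s)) b↦r

  step-places-back : ∀ n p s → ∃[ x ] (proj₁ p , x , proj₂ p) ∈ step n p s
  step-places-back n (a , b) s = back-places a b (forth a b (cover n a b s))

  step-covers : ∀ n p s → A (proj₁ p) (proj₂ p) ≡ true → Covered (step n p s) (proj₁ p) (proj₂ p)
  step-covers n (a , b) s ab =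
    let j , e = cover-covers n a b s ab in
    j , Edge-mono (back-⊇ a b (forth a b (cover n a b s)) ∘ forth-⊇ a b (cover n a b s)) e

  Placed : ℕ → ℕ → ℕ → Set
  Placed j x r = ∃[ n ] (j , x , r) ∈ stage n

  placed-functional : ∀ {j x r r′} → Placed j x r → Placed j x r′ → r ≡ r′
  placed-functional (m , x↦r) (n , x↦r′) =
    functional (valid-stage (m ⊔ n)) (stage-mono (m≤m⊔n m n) x↦r) (stage-mono (m≤n⊔m m n) x↦r′)

  placed-injective : ∀ {j x x′ r} → Placed j x r → Placed j x′ r → x ≡ x′
  placed-injective (m , x↦r) (n , x′↦r) =
    injective (valid-stage (m ⊔ n)) (stage-mono (m≤m⊔n m n) x↦r) (stage-mono (m≤n⊔m m n) x′↦r)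

  every-vertex-placed : ∀ j x → ∃[ r ] Placed j x r
  every-vertex-placed = unpair-elim (λ j x → ∃[ r ] Placed j x r) λ n →
    let r , x↦r = step-places-forth n (unpair n) (stage n) in r , suc n , x↦r

  every-vertex-occupied : ∀ j r → ∃[ x ] Placed j x r
  every-vertex-occupied = unpair-elim (λ j r → ∃[ x ] Placed j x r) λ n →
    let x , x↦r = step-places-back n (unpair n) (stage n) in x , suc n , x↦r

  position : ℕ → ℕ → ℕ
  position j x = proj₁ (every-vertex-placed j x)

  occupant : ℕ → ℕ → ℕ
  occupant j r = proj₁ (every-vertex-occupied j r)

  occupant-unique : ∀ {j x r} → Placed j x r → occupant j r ≡ x
  occupant-unique = placed-injective (proj₂ (every-vertex-occupied _ _))

  edge-occupants : ∀ {n j a b} → Edge (stage n) j a b → G j (occupant j a) (occupant j b) ≡ true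
  edge-occupants {n} {j} (x , x↦a , y , y↦b , xy) =
    subst₂ (λ x y → G j x y ≡ true) (≡.sym (occupant-unique (n , x↦a)))
                                    (≡.sym (occupant-unique (n , y↦b))) xy

  occupants-edge : ∀ {j a b} → G j (occupant j a) (occupant j b) ≡ true → ∃[ n ] Edge (stage n) j a b
  occupants-edge {j} {a} {b} xy =
    let m , x↦a = proj₂ (every-vertex-occupied j a) ; n , y↦b = proj₂ (every-vertex-occupied j b) in
    m ⊔ n , _ , stage-mono (m≤m⊔n m n) x↦a , _ , stage-mono (m≤n⊔m m n) y↦b , xy

  occupant-position : ∀ j x → occupant j (position j x) ≡ x
  occupant-position j x = occupant-unique {r = position j x} (proj₂ (every-vertex-placed j x))

  position-occupant : ∀ j r → position j (occupant j r) ≡ r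
  position-occupant j r = placed-functional {r = position j (occupant j r)} {r}
                            (proj₂ (every-vertex-placed j (occupant j r))) (proj₂ (every-vertex-occupied j r))

  occupants-sound : ∀ j a b → G j (occupant j a) (occupant j b) ≡ true → A a b ≡ true
  occupants-sound j a b xy = let n , e = occupants-edge xy in edge-sound (valid-stage n) e

  occupants-disjoint : ∀ i j a b → G i (occupant i a) (occupant i b) ≡ true →
                       G j (occupant j a) (occupant j b) ≡ true → i ≡ j
  occupants-disjoint i j a b xy x′y′ =
    let m , e = occupants-edge xy ; n , e′ = occupants-edge x′y′ in
    edge-unique (valid-stage (m ⊔ n)) (Edge-mono (stage-mono (m≤m⊔n m n)) e)
                                      (Edge-mono (stage-mono (m≤n⊔m m n)) e′)

  occupants-cover : ∀ a b → A a b ≡ true → ∃[ j ] G j (occupant j a) (occupant j b) ≡ true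
  occupants-cover = unpair-elim (λ a b → A a b ≡ true → ∃[ j ] G j (occupant j a) (occupant j b) ≡ true)
                                λ n ab →
    let j , e = step-covers n (unpair n) (stage n) ab in j , edge-occupants {suc n} e

  ℛ : Graph
  ℛ = record { V = ℕ ; adj = A ; sym = A-sym ; irrefl = A-irrefl }

  𝒢 : ℕ → Graph
  𝒢 j = record { V = ℕ ; adj = G j ; sym = G-sym j ; irrefl = G-irrefl j }

  packing : Packing ℛ 𝒢
  packing = record
    { place          = λ j → mk↔ₛ′ (occupant j) (position j) (occupant-position j) (position-occupant j)
    ; edges-sound    = occupants-sound
    ; edges-disjoint = occupants-disjoint
    ; edges-covered  = occupants-cover
    }

proposition4p3 : (R : Graph) → CountablyInfinite R → Extension R →
    (Γ : ℕ → Graph) →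
    (∀ i → CountablyInfinite (Γ i)) → (∀ i → LocallyFinite (Γ i)) → (∀ i → HasEdge (Γ i)) →
    ∃[ Δ ] (EdgePartition R Δ × (∀ i → asGraph (Δ i) ≅ Γ i))
proposition4p3 R eR extension Γ eΓ locally-finite has-edge =
  Packing⇒EdgePartition (relabel-Packing {R} {Γ} eR eΓ packing)
  where
  R′ : Graph
  R′ = relabel R eR

  Γ′ : ℕ → Graph
  Γ′ j = relabel (Γ j) (eΓ j)

  common-neighbours : CommonNeighbours R
  common-neighbours = Extension⇒CommonNeighbours R (via-injection (↔⇒↣ eR) _≟_) extension

  open Construction (adj R′) (sym R′) (irrefl R′) (relabel-CommonNeighbours {R} eR common-neighbours)
                    (λ j → adj (Γ′ j)) (λ j → sym (Γ′ j)) (λ j → irrefl (Γ′ j))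
                    (λ j → relabel-LocallyFinite {Γ j} (eΓ j) (locally-finite j))
                    (λ j → relabel-HasEdge {Γ j} (eΓ j) (has-edge j))
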